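{- Let $X$ be a finite commutable set. In $\mathcal{T}X$: $0$ and $1$ are derivable with $\delta_x(0)=\delta_x(1)=0$; each symbol $y\in X$ is derivable with $\delta_x(y)=1$ if $y=x$ and $\delta_x(y)=0$ otherwise; if $e_1,e_2$ are derivable then $e_1+e_2$ is derivable with $\delta_x(e_1+e_2)=\delta_x(e_1)+\delta_x(e_2)$; if $e_1,e_2$ are derivable then $e_1e_2$ is derivable with $\delta_x(e_1e_2)=[e_1]_0\delta_x(e_2)+\delta_x(e_1)e_2$; if $e_1$ is derivable and $[e_1]_0=0$ then $e_1e_2$ is derivable for any $e_2$, with $\delta_x(e_1e_2)=\delta_x(e_1)e_2$; and if $e$ is derivable and $[e]_0=0$ then $e^*$ is derivable with $\delta_x(e^*)=\delta_x(e)e^*$. (Here $\delta_x$ of the arguments denote any families witnessing their derivability.)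
   Context: Pre-Kleene algebra: constants $0,1$, operations $+,\cdot,{}^*$ with $(+,0)$ a commutative idempotent monoid, $(\cdot,1)$ a monoid, two-sided distributivity, $0$ absorbing, and $x^*=1+xx^*$; order $x\le y$ iff $x+y=y$. A commutable set is a set with a reflexive symmetric relation $\sim$. $\mathcal{T}X$ is the pre-Kleene algebra freely generated by $X$ subject to $xy=yx$ for $x\sim y$. $\mathbb{2}=\{0\le1\}$ is the two-element pre-Kleene algebra (disjunction, conjunction, $x^*=1$), and $[-]_0:\mathcal{T}X\to\mathbb{2}$ is the morphism sending every $x\in X$ to $0$; its values are regarded as the elements $0,1$ of $\mathcal{T}X$. A term $e\in\mathcal{T}X$ is derivable if there is a family $\{\delta_x(e)\}_{x\in X}\subseteq\mathcal{T}X$ with $e=[e]_0+\sum_{x\in X}x\,\delta_x(e)$. -}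

module Defs where

open import Data.Nat using (ℕ; zero; suc)
open import Data.Fin using (Fin; zero; suc; _≟_)
open import Data.Bool using (Bool; true; false; if_then_else_)
open import Relation.Nullary using (does)
open import Relation.Binary using (Reflexive; Symmetric)
open import Data.Product using (_×_)
open import Level using (0ℓ)

record CommutableSet (n : ℕ) : Set₁ where
  field
    _~_   : Fin n → Fin n → Set
    ~-refl : Reflexive _~_
    ~-sym  : Symmetric _~_

data Term (n : ℕ) : Set where
  𝟘 𝟙  : Term n
  var  : Fin n → Term n
  _⊕_  : Term n → Term n → Term n
  _⊙_  : Term n → Term n → Term n
  _⋆   : Term n → Term n

infixl 6 _⊕_
infixl 7 _⊙_
infix 8 _⋆

-- The congruence presenting 𝒯X: pre-Kleene algebra axioms plus xy = yx for x ~ y.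
module _ {n : ℕ} (C : CommutableSet n) where
  open CommutableSet C

  infix 4 _≈_
  data _≈_ : Term n → Term n → Set where
    ≈-refl  : ∀ {a} → a ≈ a
    ≈-sym   : ∀ {a b} → a ≈ b → b ≈ a
    ≈-trans : ∀ {a b c} → a ≈ b → b ≈ c → a ≈ c
    ⊕-cong  : ∀ {a a' b b'} → a ≈ a' → b ≈ b' → a ⊕ b ≈ a' ⊕ b'
    ⊙-cong  : ∀ {a a' b b'} → a ≈ a' → b ≈ b' → a ⊙ b ≈ a' ⊙ b'
    ⋆-cong  : ∀ {a a'} → a ≈ a' → a ⋆ ≈ a' ⋆
    ⊕-assoc : ∀ a b c → (a ⊕ b) ⊕ c ≈ a ⊕ (b ⊕ c)
    ⊕-comm  : ∀ a b → a ⊕ b ≈ b ⊕ a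
    ⊕-idem  : ∀ a → a ⊕ a ≈ a
    ⊕-idˡ   : ∀ a → 𝟘 ⊕ a ≈ a
    ⊙-assoc : ∀ a b c → (a ⊙ b) ⊙ c ≈ a ⊙ (b ⊙ c)
    ⊙-idˡ   : ∀ a → 𝟙 ⊙ a ≈ a
    ⊙-idʳ   : ∀ a → a ⊙ 𝟙 ≈ a
    distribˡ : ∀ a b c → a ⊙ (b ⊕ c) ≈ (a ⊙ b) ⊕ (a ⊙ c)
    distribʳ : ∀ a b c → (b ⊕ c) ⊙ a ≈ (b ⊙ a) ⊕ (c ⊙ a)
    zeroˡ   : ∀ a → 𝟘 ⊙ a ≈ 𝟘
    zeroʳ   : ∀ a → a ⊙ 𝟘 ≈ 𝟘
    unfold  : ∀ a → a ⋆ ≈ 𝟙 ⊕ (a ⊙ (a ⋆))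
    comm    : ∀ {x y} → x ~ y → var x ⊙ var y ≈ var y ⊙ var x

-- The morphism [-]₀ : 𝒯X → 𝟚 sending every generator to 0 (on representatives).
[_]₀ : ∀ {n} → Term n → Bool
[ 𝟘 ]₀ = false
[ 𝟙 ]₀ = true
[ var _ ]₀ = false
[ a ⊕ b ]₀ = if [ a ]₀ then true else [ b ]₀
[ a ⊙ b ]₀ = if [ a ]₀ then [ b ]₀ else false
[ a ⋆ ]₀ = true

⌜_⌝ : ∀ {n} → Bool → Term n
⌜ false ⌝ = 𝟘
⌜ true ⌝ = 𝟙

sumFin : ∀ {n m} → (Fin m → Term n) → Term n
sumFin {m = zero} f = 𝟘
sumFin {m = suc m} f = f zero ⊕ sumFin (λ i → f (suc i))

-- δ witnesses derivability of e:  e = [e]₀ + Σₓ x δ(x)  in 𝒯X.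
DerivWitness : ∀ {n} (C : CommutableSet n) → Term n → (Fin n → Term n) → Set
DerivWitness C e δ = _≈_ C e (⌜ [ e ]₀ ⌝ ⊕ sumFin (λ x → var x ⊙ δ x))

kron : ∀ {n} → Fin n → Fin n → Term n
kron x y = if does (x ≟ y) then 𝟙 else 𝟘

-- A witness writes e as its constant term [e]₀ plus a linear part Σₓ x δₓ, and right
-- multiplication preserves this shape: e f = [e]₀ f + Σₓ x (δₓ f).  For e₁ e₂ the term
-- [e₁]₀ e₂ is expanded with the witness of e₂, using that the constants 0 and 1 are
-- central; when [e₁]₀ = 0 it vanishes, and e⋆ = 1 + e e⋆ reduces the star rule to that
-- case.
module Submission where

open import Defs
open import Algebra.Bundles using (Semiring)
open import Data.Nat using (ℕ; zero; suc)
open import Data.Fin using (Fin; zero; suc; _≟_; punchIn)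
open import Data.Fin.Properties using (punchInᵢ≢i)
open import Data.Bool using (Bool; true; false)
open import Data.Product using (_×_; _,_)
open import Function using (_∘_)
open import Level using (0ℓ)
open import Relation.Binary.PropositionalEquality
  using (_≡_; _≢_; refl; cong; sym)
open import Relation.Nullary.Decidable using (dec-true; dec-false)

module _ {n : ℕ} (C : CommutableSet n) where

  infix 4 _≋_
  _≋_ : Term n → Term n → Set
  _≋_ = _≈_ C

  termSemiring : Semiring 0ℓ 0ℓ
  termSemiring = record
    { Carrier = Term n
    ; _≈_ = _≋_
    ; _+_ = _⊕_
    ; _*_ = _⊙_
    ; 0# = 𝟘
    ; 1# = 𝟙
    ; isSemiring = record
      { isSemiringWithoutAnnihilatingZero = record
        { +-isCommutativeMonoid = record
          { isMonoid = record
            { isSemigroup = record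
              { isMagma = record
                { isEquivalence = record { refl = ≈-refl ; sym = ≈-sym ; trans = ≈-trans }
                ; ∙-cong = ⊕-cong }
              ; assoc = ⊕-assoc }
            ; identity = ⊕-idˡ , λ a → ≈-trans (⊕-comm a 𝟘) (⊕-idˡ a) }
          ; comm = ⊕-comm }
        ; *-cong = ⊙-cong
        ; *-assoc = ⊙-assoc
        ; *-identity = ⊙-idˡ , ⊙-idʳ
        ; distrib = distribˡ , distribʳ }
      ; zero = zeroˡ , zeroʳ } }

  open Semiring termSemiring using (setoid; +-identityʳ; +-commutativeSemigroup)
  open import Algebra.Properties.Semiring.Sum termSemiring
    using (sum; sum-cong-≋; sum-replicate-zero; sum-remove; ∑-distrib-+;
           *-distribˡ-sum; *-distribʳ-sum)
  open import Algebra.Properties.CommutativeSemigroup +-commutativeSemigroup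
    using (interchange)
  open import Relation.Binary.Reasoning.Setoid setoid

  sumFin≡sum : ∀ {m} (f : Fin m → Term n) → sumFin f ≡ sum f
  sumFin≡sum {zero}  f = refl
  sumFin≡sum {suc m} f = cong (f zero ⊕_) (sumFin≡sum (λ i → f (suc i)))

  sum-≋𝟘 : ∀ {m} (f : Fin m → Term n) → (∀ i → f i ≋ 𝟘) → sum f ≋ 𝟘
  sum-≋𝟘 {m} f f≋𝟘 = ≈-trans (sum-cong-≋ f≋𝟘) (sum-replicate-zero m)

  linear : (Fin n → Term n) → Term n
  linear δ = sum (λ x → var x ⊙ δ x)

  witness⇒linear : ∀ e δ → DerivWitness C e δ → e ≋ ⌜ [ e ]₀ ⌝ ⊕ linear δ
  witness⇒linear e δ w rewrite sym (sumFin≡sum (λ x → var x ⊙ δ x)) = w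

  linear⇒witness : ∀ e δ → e ≋ ⌜ [ e ]₀ ⌝ ⊕ linear δ → DerivWitness C e δ
  linear⇒witness e δ w rewrite sumFin≡sum (λ x → var x ⊙ δ x) = w

  linear-𝟘 : linear (λ _ → 𝟘) ≋ 𝟘
  linear-𝟘 = sum-≋𝟘 (λ x → var x ⊙ 𝟘) (λ x → zeroʳ (var x))

  linear-⊕ : ∀ δ₁ δ₂ → linear (λ x → δ₁ x ⊕ δ₂ x) ≋ linear δ₁ ⊕ linear δ₂
  linear-⊕ δ₁ δ₂ = begin
    sum (λ x → var x ⊙ (δ₁ x ⊕ δ₂ x))
      ≈⟨ sum-cong-≋ (λ x → distribˡ (var x) (δ₁ x) (δ₂ x)) ⟩
    sum (λ x → var x ⊙ δ₁ x ⊕ var x ⊙ δ₂ x)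
      ≈⟨ ∑-distrib-+ (λ x → var x ⊙ δ₁ x) (λ x → var x ⊙ δ₂ x) ⟩
    linear δ₁ ⊕ linear δ₂ ∎

  linear-⊙ʳ : ∀ δ f → linear δ ⊙ f ≋ linear (λ x → δ x ⊙ f)
  linear-⊙ʳ δ f = ≈-trans (*-distribʳ-sum f (λ x → var x ⊙ δ x))
                          (sum-cong-≋ (λ x → ⊙-assoc (var x) (δ x) f))

  ⌜⌝-central : (b : Bool) (a : Term n) → ⌜ b ⌝ ⊙ a ≋ a ⊙ ⌜ b ⌝
  ⌜⌝-central true  a = ≈-trans (⊙-idˡ a) (≈-sym (⊙-idʳ a))
  ⌜⌝-central false a = ≈-trans (zeroˡ a) (≈-sym (zeroʳ a))

  ⌜⌝⊙linear : (b : Bool) (δ : Fin n → Term n) → ⌜ b ⌝ ⊙ linear δ ≋ linear (λ x → ⌜ b ⌝ ⊙ δ x)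
  ⌜⌝⊙linear b δ = ≈-trans (*-distribˡ-sum ⌜ b ⌝ (λ x → var x ⊙ δ x)) (sum-cong-≋ slide)
    where
    slide : ∀ x → ⌜ b ⌝ ⊙ (var x ⊙ δ x) ≋ var x ⊙ (⌜ b ⌝ ⊙ δ x)
    slide x = begin
      ⌜ b ⌝ ⊙ (var x ⊙ δ x)   ≈⟨ ≈-sym (⊙-assoc _ _ _) ⟩
      (⌜ b ⌝ ⊙ var x) ⊙ δ x   ≈⟨ ⊙-cong (⌜⌝-central b (var x)) ≈-refl ⟩
      (var x ⊙ ⌜ b ⌝) ⊙ δ x   ≈⟨ ⊙-assoc _ _ _ ⟩
      var x ⊙ (⌜ b ⌝ ⊙ δ x)   ∎

  kron-diag : (y : Fin n) → kron y y ≡ 𝟙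
  kron-diag y rewrite dec-true (y ≟ y) refl = refl

  kron-off : {y x : Fin n} → y ≢ x → kron y x ≡ 𝟘
  kron-off {y} {x} y≢x rewrite dec-false (y ≟ x) y≢x = refl

  sum-single : ∀ {m} (t : Fin m → Term n) y → (∀ x → x ≢ y → t x ≋ 𝟘) → sum t ≋ t y
  sum-single {suc m} t y t≋𝟘 = begin
    sum t                             ≈⟨ sum-remove {i = y} t ⟩
    t y ⊕ sum (λ j → t (punchIn y j))
      ≈⟨ ⊕-cong ≈-refl (sum-≋𝟘 (λ j → t (punchIn y j)) (λ j → t≋𝟘 _ (punchInᵢ≢i y j))) ⟩
    t y ⊕ 𝟘                           ≈⟨ +-identityʳ (t y) ⟩
    t y                               ∎

  linear-kron : ∀ y → linear (kron y) ≋ var y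
  linear-kron y = begin
    linear (kron y)
      ≈⟨ sum-single (λ x → var x ⊙ kron y x) y (λ x x≢y → ⊙-kron-off (var x) (x≢y ∘ sym)) ⟩
    var y ⊙ kron y y  ≈⟨ ⊙-cong ≈-refl (≡⇒≋ (kron-diag y)) ⟩
    var y ⊙ 𝟙         ≈⟨ ⊙-idʳ (var y) ⟩
    var y             ∎
    where
    ≡⇒≋ : ∀ {a b} → a ≡ b → a ≋ b
    ≡⇒≋ refl = ≈-refl
    ⊙-kron-off : ∀ a {x} → y ≢ x → a ⊙ kron y x ≋ 𝟘
    ⊙-kron-off a y≢x = ≈-trans (⊙-cong ≈-refl (≡⇒≋ (kron-off y≢x))) (zeroʳ a)

  𝟙⊕⌜⌝ : (b : Bool) → 𝟙 ⊕ ⌜ b ⌝ ≋ 𝟙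
  𝟙⊕⌜⌝ true  = ⊕-idem 𝟙
  𝟙⊕⌜⌝ false = +-identityʳ 𝟙

  ⌜[]₀⌝-⊕ : (e₁ e₂ : Term n) → ⌜ [ e₁ ]₀ ⌝ ⊕ ⌜ [ e₂ ]₀ ⌝ ≋ ⌜ [ e₁ ⊕ e₂ ]₀ ⌝
  ⌜[]₀⌝-⊕ e₁ e₂ with [ e₁ ]₀
  ... | true  = 𝟙⊕⌜⌝ [ e₂ ]₀
  ... | false = ⊕-idˡ _

  ⌜[]₀⌝-⊙ : (e₁ e₂ : Term n) → ⌜ [ e₁ ]₀ ⌝ ⊙ ⌜ [ e₂ ]₀ ⌝ ≋ ⌜ [ e₁ ⊙ e₂ ]₀ ⌝
  ⌜[]₀⌝-⊙ e₁ e₂ with [ e₁ ]₀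
  ... | true  = ⊙-idˡ _
  ... | false = zeroˡ _

  ⊙-expandˡ : ∀ e δ f → DerivWitness C e δ →
              e ⊙ f ≋ ⌜ [ e ]₀ ⌝ ⊙ f ⊕ linear (λ x → δ x ⊙ f)
  ⊙-expandˡ e δ f w = begin
    e ⊙ f                                 ≈⟨ ⊙-cong (witness⇒linear e δ w) ≈-refl ⟩
    (⌜ [ e ]₀ ⌝ ⊕ linear δ) ⊙ f           ≈⟨ distribʳ f _ _ ⟩
    ⌜ [ e ]₀ ⌝ ⊙ f ⊕ linear δ ⊙ f         ≈⟨ ⊕-cong ≈-refl (linear-⊙ʳ δ f) ⟩
    ⌜ [ e ]₀ ⌝ ⊙ f ⊕ linear (λ x → δ x ⊙ f) ∎

  witness-𝟘 : DerivWitness C 𝟘 (λ _ → 𝟘)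
  witness-𝟘 = linear⇒witness 𝟘 _ (≈-sym (≈-trans (⊕-idˡ _) linear-𝟘))

  witness-𝟙 : DerivWitness C 𝟙 (λ _ → 𝟘)
  witness-𝟙 = linear⇒witness 𝟙 _ (≈-sym (≈-trans (⊕-cong ≈-refl linear-𝟘) (+-identityʳ 𝟙)))

  witness-var : ∀ y → DerivWitness C (var y) (kron y)
  witness-var y = linear⇒witness (var y) _ (≈-sym (≈-trans (⊕-idˡ _) (linear-kron y)))

  witness-⊕ : ∀ e₁ e₂ δ₁ δ₂ → DerivWitness C e₁ δ₁ → DerivWitness C e₂ δ₂ →
              DerivWitness C (e₁ ⊕ e₂) (λ x → δ₁ x ⊕ δ₂ x)
  witness-⊕ e₁ e₂ δ₁ δ₂ w₁ w₂ = linear⇒witness (e₁ ⊕ e₂) _ (begin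
    e₁ ⊕ e₂
      ≈⟨ ⊕-cong (witness⇒linear e₁ δ₁ w₁) (witness⇒linear e₂ δ₂ w₂) ⟩
    (⌜ [ e₁ ]₀ ⌝ ⊕ linear δ₁) ⊕ (⌜ [ e₂ ]₀ ⌝ ⊕ linear δ₂)
      ≈⟨ interchange _ _ _ _ ⟩
    (⌜ [ e₁ ]₀ ⌝ ⊕ ⌜ [ e₂ ]₀ ⌝) ⊕ (linear δ₁ ⊕ linear δ₂)
      ≈⟨ ⊕-cong (⌜[]₀⌝-⊕ e₁ e₂) (≈-sym (linear-⊕ δ₁ δ₂)) ⟩
    ⌜ [ e₁ ⊕ e₂ ]₀ ⌝ ⊕ linear (λ x → δ₁ x ⊕ δ₂ x) ∎)

  witness-⊙ : ∀ e₁ e₂ δ₁ δ₂ → DerivWitness C e₁ δ₁ → DerivWitness C e₂ δ₂ →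
              DerivWitness C (e₁ ⊙ e₂) (λ x → (⌜ [ e₁ ]₀ ⌝ ⊙ δ₂ x) ⊕ (δ₁ x ⊙ e₂))
  witness-⊙ e₁ e₂ δ₁ δ₂ w₁ w₂ = linear⇒witness (e₁ ⊙ e₂) _ (begin
    e₁ ⊙ e₂
      ≈⟨ ⊙-expandˡ e₁ δ₁ e₂ w₁ ⟩
    c₁ ⊙ e₂ ⊕ linear (λ x → δ₁ x ⊙ e₂)
      ≈⟨ ⊕-cong (⊙-cong ≈-refl (witness⇒linear e₂ δ₂ w₂)) ≈-refl ⟩
    c₁ ⊙ (⌜ [ e₂ ]₀ ⌝ ⊕ linear δ₂) ⊕ linear (λ x → δ₁ x ⊙ e₂)
      ≈⟨ ⊕-cong (distribˡ c₁ _ _) ≈-refl ⟩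
    (c₁ ⊙ ⌜ [ e₂ ]₀ ⌝ ⊕ c₁ ⊙ linear δ₂) ⊕ linear (λ x → δ₁ x ⊙ e₂)
      ≈⟨ ⊕-cong (⊕-cong (⌜[]₀⌝-⊙ e₁ e₂) (⌜⌝⊙linear [ e₁ ]₀ δ₂)) ≈-refl ⟩
    (⌜ [ e₁ ⊙ e₂ ]₀ ⌝ ⊕ linear (λ x → c₁ ⊙ δ₂ x)) ⊕ linear (λ x → δ₁ x ⊙ e₂)
      ≈⟨ ⊕-assoc _ _ _ ⟩
    ⌜ [ e₁ ⊙ e₂ ]₀ ⌝ ⊕ (linear (λ x → c₁ ⊙ δ₂ x) ⊕ linear (λ x → δ₁ x ⊙ e₂))
      ≈⟨ ⊕-cong ≈-refl (≈-sym (linear-⊕ _ _)) ⟩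
    ⌜ [ e₁ ⊙ e₂ ]₀ ⌝ ⊕ linear (λ x → c₁ ⊙ δ₂ x ⊕ δ₁ x ⊙ e₂) ∎)
    where
    c₁ : Term n
    c₁ = ⌜ [ e₁ ]₀ ⌝

  witness-⊙-[]₀≡false : ∀ e₁ e₂ δ₁ → DerivWitness C e₁ δ₁ → [ e₁ ]₀ ≡ false →
                        DerivWitness C (e₁ ⊙ e₂) (λ x → δ₁ x ⊙ e₂)
  witness-⊙-[]₀≡false e₁ e₂ δ₁ w₁ [e₁]₀≡false = linear⇒witness (e₁ ⊙ e₂) _
    (≈-trans (⊙-expandˡ e₁ δ₁ e₂ w₁) (⊕-cong constant-part ≈-refl))
    where
    constant-part : ⌜ [ e₁ ]₀ ⌝ ⊙ e₂ ≋ ⌜ [ e₁ ⊙ e₂ ]₀ ⌝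
    constant-part rewrite [e₁]₀≡false = zeroˡ e₂

  witness-⋆ : ∀ e δ → DerivWitness C e δ → [ e ]₀ ≡ false →
              DerivWitness C (e ⋆) (λ x → δ x ⊙ (e ⋆))
  witness-⋆ e δ w [e]₀≡false = linear⇒witness (e ⋆) _ (begin
    e ⋆                                 ≈⟨ unfold e ⟩
    𝟙 ⊕ e ⊙ e ⋆                         ≈⟨ ⊕-cong ≈-refl (witness⇒linear _ _ w⊙) ⟩
    𝟙 ⊕ (⌜ [ e ⊙ e ⋆ ]₀ ⌝ ⊕ linear δ⋆)   ≈⟨ ≈-sym (⊕-assoc _ _ _) ⟩
    (𝟙 ⊕ ⌜ [ e ⊙ e ⋆ ]₀ ⌝) ⊕ linear δ⋆   ≈⟨ ⊕-cong (𝟙⊕⌜⌝ [ e ⊙ e ⋆ ]₀) ≈-refl ⟩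
    𝟙 ⊕ linear δ⋆                       ∎)
    where
    δ⋆ : Fin n → Term n
    δ⋆ x = δ x ⊙ e ⋆
    w⊙ : DerivWitness C (e ⊙ e ⋆) δ⋆
    w⊙ = witness-⊙-[]₀≡false e (e ⋆) δ w [e]₀≡false

mainTheorem11 : (n : ℕ) (C : CommutableSet n) →
    DerivWitness C 𝟘 (λ _ → 𝟘)
    × DerivWitness C 𝟙 (λ _ → 𝟘)
    × (∀ (y : Fin n) → DerivWitness C (var y) (λ x → kron y x))
    × (∀ e₁ e₂ δ₁ δ₂ → DerivWitness C e₁ δ₁ → DerivWitness C e₂ δ₂ →
    DerivWitness C (e₁ ⊕ e₂) (λ x → δ₁ x ⊕ δ₂ x))
    × (∀ e₁ e₂ δ₁ δ₂ → DerivWitness C e₁ δ₁ → DerivWitness C e₂ δ₂ →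
    DerivWitness C (e₁ ⊙ e₂) (λ x → (⌜ [ e₁ ]₀ ⌝ ⊙ δ₂ x) ⊕ (δ₁ x ⊙ e₂)))
    × (∀ e₁ e₂ δ₁ → DerivWitness C e₁ δ₁ → [ e₁ ]₀ ≡ false →
    DerivWitness C (e₁ ⊙ e₂) (λ x → δ₁ x ⊙ e₂))
    × (∀ e δ → DerivWitness C e δ → [ e ]₀ ≡ false →
    DerivWitness C (e ⋆) (λ x → δ x ⊙ (e ⋆)))
mainTheorem11 n C =
    witness-𝟘 C , witness-𝟙 C , witness-var C
  , witness-⊕ C , witness-⊙ C , witness-⊙-[]₀≡false C , witness-⋆ C
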